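{- Let $\Gamma$ be a finite simple graph whose edges are each colored with exactly one color from $C = \{1,\dots,6\}$, and for $i \in C$ let $C_i$ be the number of edges of color $i$. Fix a rainbow $6$-edge-coloring of $K_4$ (each of the six edges of $K_4$ gets a distinct color from $C$), and let $H$ be the number of copies of $K_4$ in $\Gamma$ whose edge-coloring is this fixed rainbow coloring. Then $H \le \sqrt[3]{\prod_{i=1}^6 C_i}$.
   Context: A copy of $K_4$ with the fixed coloring means a set of four pairwise adjacent vertices of $\Gamma$ such that the induced edge-colored $K_4$ is isomorphic (as an edge-colored graph, with colors preserved) to the fixed rainbow-colored $K_4$. -}

module Defs where

open import Data.Nat using (ℕ) renaming (zero to zeroℕ; suc to sucℕ)
open import Data.Fin using (Fin; zero; suc; _<?_)
open import Data.Fin.Properties using (_≟_; any?; all?)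
open import Data.Fin.Subset using (Subset; _∈_; inside; outside)
open import Data.Fin.Subset.Properties using (_∈?_)
open import Data.Maybe using (Maybe; just; nothing)
import Data.Maybe.Properties as MaybeP
open import Data.List using (List; []; _∷_; _++_; map; filter; length; allFin; cartesianProduct)
open import Data.Nat.ListAction using (product)
open import Data.Vec using (Vec; lookup; tabulate) renaming ([] to []ᵛ; _∷_ to _∷ᵛ_)
open import Data.Vec.Properties using (lookup∘tabulate)
open import Data.Product using (Σ; ∃; _×_; _,_; proj₁; proj₂)
open import Data.Sum using (_⊎_)
open import Relation.Nullary using (Dec; ¬_; yes; no)
open import Relation.Nullary.Decidable using (_×-dec_; _→-dec_; ¬?; map′)
open import Relation.Binary.PropositionalEquality using (_≡_; _≢_; refl; sym; trans; cong; subst)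

Colour : Set
Colour = Fin 6

-- An edge-coloured finite simple graph on the vertex set Fin n:
-- col u v = just i  means {u,v} is an edge of colour i,
-- col u v = nothing means {u,v} is not an edge.

record ColouredGraph (n : ℕ) : Set where
  field
    col      : Fin n → Fin n → Maybe Colour
    col-sym  : ∀ u v → col u v ≡ col v u
    loopless : ∀ u → col u u ≡ nothing
open ColouredGraph public

-- A rainbow 6-edge-colouring of K₄ (vertices Fin 4): κ a b is the colour of
-- edge {a,b} (a ≢ b; the values κ a a are irrelevant), symmetric, and
-- distinct edges get distinct colours.
record RainbowK4 : Set where
  field
    κ        : Fin 4 → Fin 4 → Colour
    κ-sym    : ∀ a b → κ a b ≡ κ b a
    rainbow  : ∀ a b c d → a ≢ b → c ≢ d → κ a b ≡ κ c d →
               (a ≡ c × b ≡ d) ⊎ (a ≡ d × b ≡ c)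
open RainbowK4 public

-- Number of edges of colour i: unordered pairs {u,v} (counted once as u < v)
-- with col u v = just i.

allPairs : ∀ n → List (Fin n × Fin n)
allPairs n = cartesianProduct (allFin n) (allFin n)

colourCount : ∀ {n} → ColouredGraph n → Colour → ℕ
colourCount {n} Γ i =
  length (filter (λ p → (proj₁ p <? proj₂ p) ×-dec
                        MaybeP.≡-dec _≟_ (col Γ (proj₁ p) (proj₂ p)) (just i))
                 (allPairs n))

InjectiveMap : ∀ {n} → (Fin 4 → Fin n) → Set
InjectiveMap φ = ∀ a b → φ a ≡ φ b → a ≡ b

ColourPreserving : ∀ {n} → ColouredGraph n → RainbowK4 → (Fin 4 → Fin n) → Set
ColourPreserving Γ K φ = ∀ a b → a ≢ b → col Γ (φ a) (φ b) ≡ just (κ K a b)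

ImageIs : ∀ {n} → (Fin 4 → Fin n) → Subset n → Set
ImageIs φ S = ∀ x → (x ∈ S → ∃ λ a → φ a ≡ x) × ((∃ λ a → φ a ≡ x) → x ∈ S)

-- S is a copy of the coloured K₄: a set of (four) vertices together with an
-- isomorphism of edge-coloured graphs from the fixed K₄ onto the induced
-- coloured subgraph on S.
IsCopy : ∀ {n} → ColouredGraph n → RainbowK4 → Subset n → Set
IsCopy {n} Γ K S = Σ (Fin 4 → Fin n) λ φ →
  InjectiveMap φ × ColourPreserving Γ K φ × ImageIs φ S

private
  Q : ∀ {n} → ColouredGraph n → RainbowK4 → Subset n → (Fin 4 → Fin n) → Set
  Q Γ K S φ = InjectiveMap φ × ColourPreserving Γ K φ × ImageIs φ S

  Q? : ∀ {n} (Γ : ColouredGraph n) K S φ → Dec (Q Γ K S φ)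
  Q? Γ K S φ =
    all? (λ a → all? (λ b → (φ a ≟ φ b) →-dec (a ≟ b))) ×-dec
    (all? (λ a → all? (λ b → ¬? (a ≟ b) →-dec
              MaybeP.≡-dec _≟_ (col Γ (φ a) (φ b)) (just (κ K a b)))) ×-dec
     all? (λ x → ((x ∈? S) →-dec any? (λ a → φ a ≟ x)) ×-dec
                 (any? (λ a → φ a ≟ x) →-dec (x ∈? S))))

  Q-resp : ∀ {n} (Γ : ColouredGraph n) K S (φ ψ : Fin 4 → Fin n) →
           (∀ a → φ a ≡ ψ a) → Q Γ K S φ → Q Γ K S ψ
  Q-resp Γ K S φ ψ e (inj , cp , im) =
    (λ a b eq → inj a b (trans (e a) (trans eq (sym (e b))))) ,
    (λ a b a≢b → subst (λ z → col Γ z (ψ b) ≡ just (κ K a b)) (e a)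
                   (subst (λ z → col Γ (φ a) z ≡ just (κ K a b)) (e b) (cp a b a≢b))) ,
    (λ x → (λ x∈S → let (a , eq) = proj₁ (im x) x∈S in a , trans (sym (e a)) eq) ,
           (λ { (a , eq) → proj₂ (im x) (a , trans (e a) eq) }))

  vecQ? : ∀ {n} (Γ : ColouredGraph n) K S →
          Dec (∃ λ (v : Vec (Fin n) 4) → Q Γ K S (lookup v))
  vecQ? Γ K S =
    map′ (λ { (a , b , c , d , q) → (a ∷ᵛ b ∷ᵛ c ∷ᵛ d ∷ᵛ []ᵛ) , q })
         (λ { ((a ∷ᵛ b ∷ᵛ c ∷ᵛ d ∷ᵛ []ᵛ) , q) → a , b , c , d , q })
         (any? λ a → any? λ b → any? λ c → any? λ d →
            Q? Γ K S (lookup (a ∷ᵛ b ∷ᵛ c ∷ᵛ d ∷ᵛ []ᵛ)))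

isCopy? : ∀ {n} (Γ : ColouredGraph n) K S → Dec (IsCopy Γ K S)
isCopy? Γ K S =
  map′ (λ { (v , q) → lookup v , q })
       (λ { (φ , q) → tabulate φ ,
              Q-resp Γ K S φ (lookup (tabulate φ)) (λ a → sym (lookup∘tabulate φ a)) q })
       (vecQ? Γ K S)

allSubsets : ∀ n → List (Subset n)
allSubsets zeroℕ   = []ᵛ ∷ []
allSubsets (sucℕ n) = map (inside ∷ᵛ_) (allSubsets n) ++ map (outside ∷ᵛ_) (allSubsets n)

copyCount : ∀ {n} → ColouredGraph n → RainbowK4 → ℕ
copyCount {n} Γ K = length (filter (isCopy? Γ K) (allSubsets n))

colourProduct : ∀ {n} → ColouredGraph n → ℕ
colourProduct Γ = product (map (colourCount Γ) (allFin 6))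

-- Fix a perfect matching {ab, cd} of K₄. A copy of the rainbow K₄ is determined by the images
-- of the two matched edges, which are edges of Γ of colours κ(a,b) and κ(c,d); hence
-- H ≤ C_{κ(a,b)} · C_{κ(c,d)}. The three perfect matchings of K₄ partition its six edges, which
-- carry each colour exactly once, so multiplying the three bounds gives H³ ≤ ∏ᵢ Cᵢ.
module Submission where

open import Defs
open import Data.Nat using (ℕ; _≤_; _^_)

open import Data.Nat.Base using (_*_)
open import Data.Nat.Properties
  using (≤-refl; ≤-trans; ≤-reflexive; *-mono-≤; *-assoc; n≮n; ≮⇒≥; module ≤-Reasoning)
open import Data.Nat.ListAction using (product)
open import Data.Nat.ListAction.Properties using (product-↭)
open import Data.Fin.Base using (Fin; zero; suc; _<_; combine; remQuot)
open import Data.Fin.Patterns using (0F; 1F; 2F; 3F; 4F; 5F)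
open import Data.Fin.Properties using (_≟_; _<?_; all?; injective⇒≤; ≤∧≢⇒<; remQuot-combine)
open import Data.Fin.Subset using (inside; outside) renaming (_⊆_ to _⊆ₛ_)
open import Data.Fin.Subset.Properties using (⊆-antisym)
import Data.Maybe.Properties as Maybe
open import Data.Maybe.Base using (just)
open import Data.List.Base using (List; []; _∷_; length; lookup; filter; map; tabulate; allFin)
open import Data.List.Membership.Propositional using (_∈_)
open import Data.List.Membership.DecPropositional using () renaming (_∈?_ to _∈?ₗ_)
open import Data.List.Membership.Propositional.Properties
  using (∈-lookup; ∈-filter⁺; ∈-filter⁻; ∈-allFin; ∈-cartesianProduct⁺; ∈-map⁻)
open import Data.List.Membership.Propositional.Properties.WithK using (unique∧set⇒bag)
import Data.List.Membership.Setoid.Properties as SetoidMembership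
open import Data.List.Relation.Unary.Any using (here; there; index)
open import Data.List.Relation.Unary.All.Properties using (¬Any⇒All¬)
open import Data.List.Relation.Unary.All using ([])
open import Data.List.Relation.Unary.AllPairs using ([]; _∷_)
open import Data.List.Relation.Unary.Unique.Propositional using (Unique)
open import Data.List.Relation.Unary.Unique.Propositional.Properties
  using (map⁺; ++⁺; tabulate⁺; allFin⁺; filter⁺; Unique[x∷xs]⇒x∉xs)
open import Data.List.Relation.Binary.Subset.Propositional using (_⊆_)
open import Data.List.Relation.Binary.Permutation.Propositional using (_↭_)
import Data.List.Relation.Binary.Permutation.Propositional.Properties as Perm
open import Data.List.Relation.Binary.BagAndSetEquality using (∼bag⇒↭)
open import Data.Vec.Base using () renaming (_∷_ to _∷ᵛ_)
open import Data.Vec.Properties using (∷-injectiveʳ)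
open import Data.Product using (∃; _×_; _,_; proj₁; proj₂)
open import Data.Product.Properties using (,-injectiveˡ; ,-injectiveʳ)
open import Data.Sum using (_⊎_; inj₁; inj₂; swap) renaming (map to map⊎)
open import Data.Empty using (⊥-elim)
open import Function.Base using (_∘_)
open import Function.Bundles using (mk⇔)
open import Relation.Nullary using (Dec; ¬_; yes; no; contradiction)
open import Relation.Nullary.Decidable using (_×-dec_; _⊎-dec_; _→-dec_; toWitness)
open import Relation.Unary using (Decidable)
open import Relation.Binary.Definitions using (DecidableEquality)
open import Relation.Binary.PropositionalEquality
  using (_≡_; _≢_; refl; sym; trans; cong; cong₂; subst; setoid; module ≡-Reasoning)

module _ {A : Set} where

  lookup-injective : ∀ {xs : List A} → Unique xs → ∀ {i j} → lookup xs i ≡ lookup xs j → i ≡ j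
  lookup-injective {_ ∷ _} _           {zero}  {zero}  _ = refl
  lookup-injective {_ ∷ _} xs!@(_ ∷ _) {zero}  {suc j} e =
    ⊥-elim (Unique[x∷xs]⇒x∉xs xs! (subst (_∈ _) (sym e) (∈-lookup j)))
  lookup-injective {_ ∷ _} xs!@(_ ∷ _) {suc i} {zero}  e =
    ⊥-elim (Unique[x∷xs]⇒x∉xs xs! (subst (_∈ _) e (∈-lookup i)))
  lookup-injective {_ ∷ _} (_ ∷ xs!)   {suc i} {suc j} e = cong suc (lookup-injective xs! e)

  Unique∧injection⇒length≤ : ∀ {xs : List A} {m} → Unique xs →
    (f : ∀ {x} → x ∈ xs → Fin m) →
    (∀ {x y} (x∈ : x ∈ xs) (y∈ : y ∈ xs) → f x∈ ≡ f y∈ → x ≡ y) →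
    length xs ≤ m
  Unique∧injection⇒length≤ xs! f f-inj =
    injective⇒≤ {f = f ∘ ∈-lookup} (lookup-injective xs! ∘ f-inj (∈-lookup _) (∈-lookup _))

  Unique∧⊆⇒length≤ : ∀ {xs ys : List A} → Unique xs → xs ⊆ ys → length xs ≤ length ys
  Unique∧⊆⇒length≤ xs! xs⊆ys = Unique∧injection⇒length≤ xs! (index ∘ xs⊆ys)
    (λ x∈ y∈ → SetoidMembership.index-injective (setoid A) (xs⊆ys x∈) (xs⊆ys y∈))

  Unique∧⊆∧length≥⇒↭ : DecidableEquality A → ∀ {xs ys : List A} → Unique xs → Unique ys →
                       xs ⊆ ys → length ys ≤ length xs → xs ↭ ys
  Unique∧⊆∧length≥⇒↭ _≟ₐ_ {xs} {ys} xs! ys! xs⊆ys |ys|≤|xs| =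
    ∼bag⇒↭ (unique∧set⇒bag xs! ys! (mk⇔ xs⊆ys ys⊆xs))
    where
    ys⊆xs : ys ⊆ xs
    ys⊆xs {y} y∈ys with (_∈?ₗ_ _≟ₐ_) y xs
    ... | yes y∈xs = y∈xs
    ... | no  y∉xs = contradiction
      (≤-trans (Unique∧⊆⇒length≤ (¬Any⇒All¬ xs y∉xs ∷ xs!) y∷xs⊆ys) |ys|≤|xs|) (n≮n _)
      where
      y∷xs⊆ys : y ∷ xs ⊆ ys
      y∷xs⊆ys (here refl) = y∈ys
      y∷xs⊆ys (there x∈)  = xs⊆ys x∈

combine-injective : ∀ {m n} {i i′ : Fin m} {j j′ : Fin n} →
                    combine i j ≡ combine i′ j′ → i ≡ i′ × j ≡ j′
combine-injective {n = n} {i} {i′} {j} {j′} e = ,-injectiveˡ ij≡i′j′ , ,-injectiveʳ ij≡i′j′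
  where
  open ≡-Reasoning
  ij≡i′j′ : (i , j) ≡ (i′ , j′)
  ij≡i′j′ = begin
    i , j                      ≡⟨ remQuot-combine i j ⟨
    remQuot n (combine i j)    ≡⟨ cong (remQuot n) e ⟩
    remQuot n (combine i′ j′)  ≡⟨ remQuot-combine i′ j′ ⟩
    i′ , j′                    ∎

allSubsets-unique : ∀ n → Unique (allSubsets n)
allSubsets-unique ℕ.zero    = [] ∷ []
allSubsets-unique (ℕ.suc n) =
  ++⁺ (map⁺ ∷-injectiveʳ (allSubsets-unique n)) (map⁺ ∷-injectiveʳ (allSubsets-unique n)) disjoint
  where
  disjoint : ∀ {S} → ¬ (S ∈ map (inside ∷ᵛ_) (allSubsets n) × S ∈ map (outside ∷ᵛ_) (allSubsets n))
  disjoint (S∈ , S∈′) with ∈-map⁻ (inside ∷ᵛ_) S∈ | ∈-map⁻ (outside ∷ᵛ_) S∈′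
  ... | _ , _ , refl | _ , _ , ()

module _ {n : ℕ} where

  sortedEdge : Fin n → Fin n → Fin n × Fin n
  sortedEdge u v with u <? v
  ... | yes _ = u , v
  ... | no  _ = v , u

  sortedEdge-endpoint : ∀ {u v u′ v′ w} → sortedEdge u v ≡ sortedEdge u′ v′ →
                        w ≡ u ⊎ w ≡ v → w ≡ u′ ⊎ w ≡ v′
  sortedEdge-endpoint {u} {v} {u′} {v′} e w∈uv with u <? v | u′ <? v′ | e
  ... | yes _ | yes _ | refl = w∈uv
  ... | yes _ | no  _ | refl = swap w∈uv
  ... | no  _ | yes _ | refl = swap w∈uv
  ... | no  _ | no  _ | refl = w∈uv

  sortedEdge-endpoint∈image : ∀ {A : Set} {φ ψ : A → Fin n} {p q w} →
                              sortedEdge (φ p) (φ q) ≡ sortedEdge (ψ p) (ψ q) →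
                              w ≡ φ p ⊎ w ≡ φ q → ∃ λ y → ψ y ≡ w
  sortedEdge-endpoint∈image {p = p} {q} e w∈ with sortedEdge-endpoint e w∈
  ... | inj₁ refl = p , refl
  ... | inj₂ refl = q , refl

module _ {n : ℕ} (Γ : ColouredGraph n) (i : Colour) where

  colouredEdge? : Decidable (λ (p : Fin n × Fin n) →
                    proj₁ p < proj₂ p × col Γ (proj₁ p) (proj₂ p) ≡ just i)
  colouredEdge? p = (proj₁ p <? proj₂ p) ×-dec Maybe.≡-dec _≟_ (col Γ (proj₁ p) (proj₂ p)) (just i)

  colourEdges : List (Fin n × Fin n)
  colourEdges = filter colouredEdge? (allPairs n)

  sortedEdge∈colourEdges : ∀ {u v} → u ≢ v → col Γ u v ≡ just i → sortedEdge u v ∈ colourEdges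
  sortedEdge∈colourEdges {u} {v} u≢v uv∈Γᵢ with u <? v
  ... | yes u<v = ∈-filter⁺ colouredEdge? (∈-cartesianProduct⁺ (∈-allFin u) (∈-allFin v))
                    (u<v , uv∈Γᵢ)
  ... | no  u≮v = ∈-filter⁺ colouredEdge? (∈-cartesianProduct⁺ (∈-allFin v) (∈-allFin u))
                    (≤∧≢⇒< (≮⇒≥ u≮v) (u≢v ∘ sym) , trans (col-sym Γ v u) uv∈Γᵢ)

record PerfectMatching : Set where
  field
    a b c d : Fin 4
    a≢b     : a ≢ b
    c≢d     : c ≢ d
    covers  : ∀ x → (x ≡ a ⊎ x ≡ b) ⊎ (x ≡ c ⊎ x ≡ d)

module _ {n : ℕ} (Γ : ColouredGraph n) (K : RainbowK4) (M : PerfectMatching) where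
  open PerfectMatching M

  matchedEdges : (Fin 4 → Fin n) → (Fin n × Fin n) × (Fin n × Fin n)
  matchedEdges φ = sortedEdge (φ a) (φ b) , sortedEdge (φ c) (φ d)

  matchedEdges-≡⇒image⊆ : ∀ {φ ψ : Fin 4 → Fin n} → matchedEdges φ ≡ matchedEdges ψ →
                          ∀ x → ∃ λ y → ψ y ≡ φ x
  matchedEdges-≡⇒image⊆ {φ} {ψ} e x with covers x
  ... | inj₁ x∈ab =
    sortedEdge-endpoint∈image {φ = φ} {ψ} (cong proj₁ e) (map⊎ (cong φ) (cong φ) x∈ab)
  ... | inj₂ x∈cd =
    sortedEdge-endpoint∈image {φ = φ} {ψ} (cong proj₂ e) (map⊎ (cong φ) (cong φ) x∈cd)

  matchedEdges-injective : ∀ {S T} (s : IsCopy Γ K S) (t : IsCopy Γ K T) →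
                           matchedEdges (proj₁ s) ≡ matchedEdges (proj₁ t) → S ≡ T
  matchedEdges-injective (φ , _ , _ , imφ) (ψ , _ , _ , imψ) e =
    ⊆-antisym (image⊆ imφ imψ e) (image⊆ imψ imφ (sym e))
    where
    image⊆ : ∀ {S T φ ψ} → ImageIs φ S → ImageIs ψ T → matchedEdges φ ≡ matchedEdges ψ → S ⊆ₛ T
    image⊆ imφ imψ e x∈S with proj₁ (imφ _) x∈S
    ... | x′ , refl = proj₂ (imψ _) (matchedEdges-≡⇒image⊆ e x′)

  matchedEdges∈colourEdges : ∀ {S} ((φ , _) : IsCopy Γ K S) →
                             sortedEdge (φ a) (φ b) ∈ colourEdges Γ (κ K a b) ×
                             sortedEdge (φ c) (φ d) ∈ colourEdges Γ (κ K c d)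
  matchedEdges∈colourEdges (φ , φ-inj , φ-col , _) =
    sortedEdge∈colourEdges Γ _ (a≢b ∘ φ-inj a b) (φ-col a b a≢b) ,
    sortedEdge∈colourEdges Γ _ (c≢d ∘ φ-inj c d) (φ-col c d c≢d)

  copyCount≤matchedColourCounts :
    copyCount Γ K ≤ colourCount Γ (κ K a b) * colourCount Γ (κ K c d)
  copyCount≤matchedColourCounts =
    Unique∧injection⇒length≤ (filter⁺ (isCopy? Γ K) (allSubsets-unique n)) code code-injective
    where
    isCopy : ∀ {S} → S ∈ filter (isCopy? Γ K) (allSubsets n) → IsCopy Γ K S
    isCopy S∈ = proj₂ (∈-filter⁻ (isCopy? Γ K) {xs = allSubsets n} S∈)

    code : ∀ {S} → S ∈ filter (isCopy? Γ K) (allSubsets n) →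
           Fin (colourCount Γ (κ K a b) * colourCount Γ (κ K c d))
    code S∈ = let (ab∈ , cd∈) = matchedEdges∈colourEdges (isCopy S∈)
              in combine (index ab∈) (index cd∈)

    code-injective : ∀ {S T} (S∈ : S ∈ _) (T∈ : T ∈ _) → code S∈ ≡ code T∈ → S ≡ T
    code-injective S∈ T∈ e =
      let (ab∈ , cd∈) = matchedEdges∈colourEdges (isCopy S∈)
          (ab∈′ , cd∈′) = matchedEdges∈colourEdges (isCopy T∈)
          (ab≡ , cd≡) = combine-injective e
      in matchedEdges-injective (isCopy S∈) (isCopy T∈)
           (cong₂ _,_ (SetoidMembership.index-injective (setoid _) ab∈ ab∈′ ab≡)
                      (SetoidMembership.index-injective (setoid _) cd∈ cd∈′ cd≡))

matching₀₁ matching₀₂ matching₀₃ : PerfectMatching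
matching₀₁ = record
  { a = 0F ; b = 1F ; c = 2F ; d = 3F ; a≢b = λ () ; c≢d = λ ()
  ; covers = λ { 0F → inj₁ (inj₁ refl) ; 1F → inj₁ (inj₂ refl)
               ; 2F → inj₂ (inj₁ refl) ; 3F → inj₂ (inj₂ refl) }
  }
matching₀₂ = record
  { a = 0F ; b = 2F ; c = 1F ; d = 3F ; a≢b = λ () ; c≢d = λ ()
  ; covers = λ { 0F → inj₁ (inj₁ refl) ; 1F → inj₂ (inj₁ refl)
               ; 2F → inj₁ (inj₂ refl) ; 3F → inj₂ (inj₂ refl) }
  }
matching₀₃ = record
  { a = 0F ; b = 3F ; c = 1F ; d = 2F ; a≢b = λ () ; c≢d = λ ()
  ; covers = λ { 0F → inj₁ (inj₁ refl) ; 1F → inj₂ (inj₁ refl)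
               ; 2F → inj₂ (inj₂ refl) ; 3F → inj₁ (inj₂ refl) }
  }

-- The edges are listed matching by matching, in the order matching₀₁, matching₀₂, matching₀₃.
k4Edge : Fin 6 → Fin 4 × Fin 4
k4Edge 0F = 0F , 1F
k4Edge 1F = 2F , 3F
k4Edge 2F = 0F , 2F
k4Edge 3F = 1F , 3F
k4Edge 4F = 0F , 3F
k4Edge 5F = 1F , 2F

k4Edge-proper : ∀ e → proj₁ (k4Edge e) ≢ proj₂ (k4Edge e)
k4Edge-proper 0F ()
k4Edge-proper 1F ()
k4Edge-proper 2F ()
k4Edge-proper 3F ()
k4Edge-proper 4F ()
k4Edge-proper 5F ()

SameEdge : Fin 4 × Fin 4 → Fin 4 × Fin 4 → Set
SameEdge (a , b) (c , d) = (a ≡ c × b ≡ d) ⊎ (a ≡ d × b ≡ c)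

k4Edge-injective : ∀ e f → SameEdge (k4Edge e) (k4Edge f) → e ≡ f
k4Edge-injective =
  toWitness {a? = all? λ e → all? λ f → sameEdge? (k4Edge e) (k4Edge f) →-dec e ≟ f} _
  where
  sameEdge? : ∀ p q → Dec (SameEdge p q)
  sameEdge? (a , b) (c , d) = ((a ≟ c) ×-dec (b ≟ d)) ⊎-dec ((a ≟ d) ×-dec (b ≟ c))

edgeColour : RainbowK4 → Fin 6 → Colour
edgeColour K e = κ K (proj₁ (k4Edge e)) (proj₂ (k4Edge e))

edgeColour-injective : ∀ K {e f} → edgeColour K e ≡ edgeColour K f → e ≡ f
edgeColour-injective K {e} {f} eq =
  k4Edge-injective e f (rainbow K _ _ _ _ (k4Edge-proper e) (k4Edge-proper f) eq)

edgeColours↭allFin : ∀ K → tabulate (edgeColour K) ↭ allFin 6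
edgeColours↭allFin K = Unique∧⊆∧length≥⇒↭ _≟_ (tabulate⁺ (edgeColour-injective K)) (allFin⁺ 6)
  (λ {x} _ → ∈-allFin x) ≤-refl

*-mono-≤-assoc : ∀ {p q} x y {z} → p ≤ x * y → q ≤ z → p * q ≤ x * (y * z)
*-mono-≤-assoc x y {z} p≤xy q≤z = ≤-trans (*-mono-≤ p≤xy q≤z) (≤-reflexive (*-assoc x y z))

theorem1p4 : ∀ {n : ℕ} (Γ : ColouredGraph n) (K : RainbowK4) →
    copyCount Γ K ^ 3 ≤ colourProduct Γ
theorem1p4 Γ K = begin
  copyCount Γ K ^ 3
    ≤⟨ *-mono-≤-assoc (Cₑ 0F) (Cₑ 1F) (copyCount≤matchedColourCounts Γ K matching₀₁)
         (*-mono-≤-assoc (Cₑ 2F) (Cₑ 3F) (copyCount≤matchedColourCounts Γ K matching₀₂)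
           (*-mono-≤-assoc (Cₑ 4F) (Cₑ 5F) (copyCount≤matchedColourCounts Γ K matching₀₃)
             ≤-refl)) ⟩
  product (map (colourCount Γ) (tabulate (edgeColour K)))
    ≡⟨ product-↭ (Perm.map⁺ (colourCount Γ) (edgeColours↭allFin K)) ⟩
  colourProduct Γ ∎
  where
  open ≤-Reasoning
  Cₑ : Fin 6 → ℕ
  Cₑ = colourCount Γ ∘ edgeColour K
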